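{- Let $K$ be a number field containing $\sqrt{ -1}$, and let $\lambda\in\overline{K}$ with $\lambda^2-4\neq 0$. Let $X$ be the hyperelliptic curve (genus $3$) with affine equation $y^2=x^8+\lambda x^4+1$, let $\sigma$ be the automorphism $\sigma(x,y)=(\sqrt{ -1}\,x,\ y)$ of $X$, let $E'$ be the elliptic curve $y^2=x^3+2x^2+(\lambda-2)x+2(\lambda-2)$, and let $f:X\to E'$ be the morphism $f(x,y)=\left(x^2+\frac{1}{x^2},\ \frac{y}{x^2}\left(x+\frac{1}{x}\right)\right)$. Then $f-f\circ\sigma:X\to E'$ is non-constant.
   Context: The difference of morphisms to $E'$ is taken pointwise with the group law of $E'$ (origin the point at infinity). -}

module Defs where

open import Level using (Level; 0ℓ; _⊔_; Lift) renaming (suc to lsuc)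
open import Algebra.Bundles using (CommutativeRing)
open import Data.Nat using (ℕ; zero; suc)
open import Data.Integer using (ℤ; +_; -[1+_])
open import Data.List using (List; []; _∷_; map)
open import Data.List.Relation.Unary.Any using (Any)
open import Data.Vec using (Vec; []; _∷_; toList)
open import Data.Product using (Σ; _×_; _,_; ∃)
open import Data.Unit using (⊤)
open import Data.Empty using (⊥)
open import Relation.Nullary using (¬_; yes; no)
open import Relation.Binary using (Decidable)
open import Relation.Binary.PropositionalEquality using (_≡_)

-- A field is a commutative
-- ring with decidable equality, 0 ≠ 1, and a (total) inverse function
-- which is a genuine inverse on nonzero elements (0⁻¹ is junk).

record Field c ℓ : Set (lsuc (c ⊔ ℓ)) where
  field
    commutativeRing : CommutativeRing c ℓ
  open CommutativeRing commutativeRing public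
  field
    _⁻¹     : Carrier → Carrier
    inverse : ∀ x → ¬ (x ≈ 0#) → (x * (x ⁻¹)) ≈ 1#
    0≉1     : ¬ (0# ≈ 1#)
    _≟_     : Decidable _≈_

  _/_ : Carrier → Carrier → Carrier
  x / y = x * (y ⁻¹)

  fromℕ : ℕ → Carrier
  fromℕ zero    = 0#
  fromℕ (suc n) = 1# + fromℕ n

  fromℤ : ℤ → Carrier
  fromℤ (+ n)      = fromℕ n
  fromℤ -[1+ n ]   = - fromℕ (suc n)

  eval : List Carrier → Carrier → Carrier
  eval []       x = 0#
  eval (a ∷ as) x = a + (x * eval as x)

  -- monic polynomial a₀ + a₁ X + … + aₙ Xⁿ + X^(n+1)
  monic : ∀ {n} → Vec Carrier n → List Carrier
  monic []       = 1# ∷ []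
  monic (a ∷ as) = a ∷ monic as

  _² : Carrier → Carrier
  x ² = x * x

  _⁴ : Carrier → Carrier
  x ⁴ = (x ²) ²

  _⁸ : Carrier → Carrier
  x ⁸ = (x ⁴) ²

module _ {c ℓ} (F : Field c ℓ) where
  open Field F

  CharZero : Set ℓ
  CharZero = ∀ n → ¬ (fromℕ (suc n) ≈ 0#)

  AlgClosed : Set (c ⊔ ℓ)
  AlgClosed = ∀ n (as : Vec Carrier (suc n)) → ∃ λ x → eval (monic as) x ≈ 0#

  AlgebraicOverℚ : Set (c ⊔ ℓ)
  AlgebraicOverℚ = ∀ x → ∃ λ (p : List ℤ) →
    Any (λ k → ¬ (k ≡ + 0)) p × (eval (map fromℤ p) x ≈ 0#)

  -- A field F that is of characteristic 0, algebraically closed and algebraic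
  -- over ℚ is (isomorphic to) ℚ̄ = K̄ for every number field K.
  IsAlgClosureOfNumberField : Set (c ⊔ ℓ)
  IsAlgClosureOfNumberField = CharZero × AlgClosed × AlgebraicOverℚ

  data EPt : Set c where
    𝒪   : EPt
    aff : Carrier → Carrier → EPt

  _≈ₚ_ : EPt → EPt → Set ℓ
  𝒪 ≈ₚ 𝒪 = Lift ℓ ⊤
  𝒪 ≈ₚ aff _ _ = Lift ℓ ⊥
  aff _ _ ≈ₚ 𝒪 = Lift ℓ ⊥
  aff x y ≈ₚ aff x′ y′ = (x ≈ x′) × (y ≈ y′)

  module _ (lam : Carrier) where
    two : Carrier
    two = fromℕ 2

    a₂ a₄ a₆ : Carrier
    a₂ = two
    a₄ = lam - two
    a₆ = two * (lam - two)

    OnE′ : Carrier → Carrier → Set ℓ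
    OnE′ x y = (y ²) ≈ ((x * (x ²)) + (a₂ * (x ²)) + (a₄ * x) + a₆)

    negE : EPt → EPt
    negE 𝒪         = 𝒪
    negE (aff x y) = aff x (- y)

    private
      third : Carrier → Carrier → Carrier → Carrier → Carrier → EPt
      third s x₁ y₁ x₂ _ = let x₃ = (s ²) - a₂ - x₁ - x₂
                           in aff x₃ (- (y₁ + (s * (x₃ - x₁))))

    addE : EPt → EPt → EPt
    addE 𝒪 Q = Q
    addE P 𝒪 = P
    addE (aff x₁ y₁) (aff x₂ y₂) with x₁ ≟ x₂
    ... | no _  = third ((y₂ - y₁) / (x₂ - x₁)) x₁ y₁ x₂ y₂
    ... | yes _ with (y₁ + y₂) ≟ 0#
    ...   | yes _ = 𝒪
    ...   | no _  = third ((((fromℕ 3) * (x₁ ²)) + (two * (a₂ * x₁)) + a₄)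
                           / (two * y₁)) x₁ y₁ x₂ y₂

    subE : EPt → EPt → EPt
    subE P Q = addE P (negE Q)

    OnX : Carrier → Carrier → Set ℓ
    OnX x y = (y ²) ≈ ((x ⁸) + (lam * (x ⁴)) + 1#)

    f : Carrier → Carrier → EPt
    f x y = aff ((x ²) + ((x ²) ⁻¹)) ((y / (x ²)) * (x + (x ⁻¹)))

    module _ (i : Carrier) where
      σx : Carrier → Carrier
      σx x = i * x

      fMinusFσ : Carrier → Carrier → EPt
      fMinusFσ x y = subE (f x y) (f (σx x) y)

      -- non-constancy: two points of X (in the open set x ≠ 0 where the
      -- formulas for f, f∘σ are valid) with different images
      NonConstant : Set (c ⊔ ℓ)
      NonConstant = Σ Carrier λ x₁ → Σ Carrier λ y₁ → Σ Carrier λ x₂ → Σ Carrier λ y₂ →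
        OnX x₁ y₁ × ¬ (x₁ ≈ 0#) × OnX x₂ y₂ × ¬ (x₂ ≈ 0#) ×
        ¬ (fMinusFσ x₁ y₁ ≈ₚ fMinusFσ x₂ y₂)

-- At a point P = (r, s) of X with r² = i we have r⁴ = -1, and f(σP) = f(P): both
-- x-coordinates vanish and the y-coordinates agree, so (f - f∘σ)(P) = 𝒪.  At P = (1, t)
-- the x-coordinates of f(P) and f(σP) are 2 and -2, which differ in characteristic ≠ 2,
-- so (f - f∘σ)(P) is an affine point.  Both points exist because K̄ is algebraically
-- closed (s² = 2 - λ, t² = 2 + λ).
module Submission where

open import Algebra.Bundles using (CommutativeRing)
open import Algebra.Solver.Ring.AlmostCommutativeRing
  using (fromCommutativeRing; _-Raw-AlmostCommutative⟶_)
open import Data.Empty using (⊥-elim)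
open import Data.Integer.Base as ℤ using (ℤ; +_; -[1+_]; _⊖_; _◃_; sign; ∣_∣; +-*-rawRing)
open import Data.Integer.Properties using ([1+m]⊖[1+n]≡m⊖n) renaming (_≟_ to _≟ℤ_)
open import Data.Maybe.Base using (Maybe; just; nothing)
open import Data.Nat.Base as ℕ using (suc; zero)
open import Data.Nat.Properties using (+-suc)
open import Data.Product using (∃; _,_; proj₁; proj₂)
open import Data.Sign.Base as Sign using (Sign)
open import Data.Vec using ([]; _∷_)
open import Function.Base using (id)
open import Level using (0ℓ)
open import Relation.Nullary using (¬_; yes; no)
open import Relation.Binary.PropositionalEquality.Core as ≡ using (_≡_)
open import Defs

-- Coefficients in ℤ, rather than in R itself, make the solver's normal forms compute, so
-- that `refl` closes them.  The type-checking-optimised _×_ makes `con (+ 1)` reduce to 1#.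
module CommutativeRingSolver {c ℓ} (R : CommutativeRing c ℓ) where
  open CommutativeRing R
  open import Algebra.Properties.Ring ring using (-0#≈0#; -‿involutive; -‿distribˡ-*; -‿distribʳ-*)
  open import Algebra.Properties.AbelianGroup +-abelianGroup using (⁻¹-∙-comm)
  open import Algebra.Properties.CommutativeSemigroup +-commutativeSemigroup using (interchange)
  open import Algebra.Properties.Semiring.Mult.TCOptimised semiring using (_×_; 1+×; ×-homo-+; ×1-homo-*)
  open import Relation.Binary.Reasoning.Setoid setoid

  ⟦_⟧ℤ : ℤ → Carrier
  ⟦ + n ⟧ℤ      = n × 1#
  ⟦ -[1+ n ] ⟧ℤ = - (suc n × 1#)

  1+x-[1+y]≈x-y : ∀ x y → (1# + x) - (1# + y) ≈ x - y
  1+x-[1+y]≈x-y x y = begin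
    (1# + x) + - (1# + y)    ≈⟨ +-congˡ (⁻¹-∙-comm 1# y) ⟨
    (1# + x) + (- 1# + - y)  ≈⟨ interchange 1# x (- 1#) (- y) ⟩
    (1# - 1#) + (x - y)      ≈⟨ +-congʳ (-‿inverseʳ 1#) ⟩
    0# + (x - y)             ≈⟨ +-identityˡ (x - y) ⟩
    x - y                    ∎

  ⊖-homo : ∀ m n → ⟦ m ⊖ n ⟧ℤ ≈ m × 1# - n × 1#
  ⊖-homo m       zero    = sym (trans (+-congˡ -0#≈0#) (+-identityʳ _))
  ⊖-homo zero    (suc n) = sym (+-identityˡ _)
  ⊖-homo (suc m) (suc n) = begin
    ⟦ suc m ⊖ suc n ⟧ℤ                 ≡⟨ ≡.cong ⟦_⟧ℤ ([1+m]⊖[1+n]≡m⊖n m n) ⟩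
    ⟦ m ⊖ n ⟧ℤ                         ≈⟨ ⊖-homo m n ⟩
    m × 1# - n × 1#                    ≈⟨ 1+x-[1+y]≈x-y _ _ ⟨
    (1# + m × 1#) - (1# + n × 1#)      ≈⟨ +-cong (1+× m 1#) (-‿cong (1+× n 1#)) ⟨
    suc m × 1# - suc n × 1#            ∎

  +-homo : ∀ i j → ⟦ i ℤ.+ j ⟧ℤ ≈ ⟦ i ⟧ℤ + ⟦ j ⟧ℤ
  +-homo (+ m)    (+ n)    = ×-homo-+ 1# m n
  +-homo (+ m)    -[1+ n ] = ⊖-homo m (suc n)
  +-homo -[1+ m ] (+ n)    = trans (⊖-homo n (suc m)) (+-comm _ _)
  +-homo -[1+ m ] -[1+ n ] = begin
    - (suc (suc (m ℕ.+ n)) × 1#)      ≡⟨ ≡.cong (λ k → - (k × 1#)) (+-suc (suc m) n) ⟨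
    - ((suc m ℕ.+ suc n) × 1#)        ≈⟨ -‿cong (×-homo-+ 1# (suc m) (suc n)) ⟩
    - (suc m × 1# + suc n × 1#)       ≈⟨ ⁻¹-∙-comm _ _ ⟨
    - (suc m × 1#) + - (suc n × 1#)   ∎

  -‿homo : ∀ i → ⟦ ℤ.- i ⟧ℤ ≈ - ⟦ i ⟧ℤ
  -‿homo (+ zero)  = sym -0#≈0#
  -‿homo (+ suc n) = refl
  -‿homo -[1+ n ]  = sym (-‿involutive _)

  signed : Sign → Carrier → Carrier
  signed Sign.+ x = x
  signed Sign.- x = - x

  signed-cong : ∀ s {x y} → x ≈ y → signed s x ≈ signed s y
  signed-cong Sign.+ = id
  signed-cong Sign.- = -‿cong

  ◃-homo : ∀ s n → ⟦ s ◃ n ⟧ℤ ≈ signed s (n × 1#)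
  ◃-homo Sign.+ zero    = refl
  ◃-homo Sign.- zero    = sym -0#≈0#
  ◃-homo Sign.+ (suc n) = refl
  ◃-homo Sign.- (suc n) = refl

  ⟦⟧ℤ≡signed : ∀ i → ⟦ i ⟧ℤ ≡ signed (sign i) (∣ i ∣ × 1#)
  ⟦⟧ℤ≡signed (+ n)    = ≡.refl
  ⟦⟧ℤ≡signed -[1+ n ] = ≡.refl

  signed-* : ∀ s t x y → signed (s Sign.* t) (x * y) ≈ signed s x * signed t y
  signed-* Sign.+ Sign.+ x y = refl
  signed-* Sign.+ Sign.- x y = -‿distribʳ-* x y
  signed-* Sign.- Sign.+ x y = -‿distribˡ-* x y
  signed-* Sign.- Sign.- x y = begin
    x * y         ≈⟨ -‿involutive _ ⟨
    - - (x * y)   ≈⟨ -‿cong (-‿distribˡ-* x y) ⟩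
    - (- x * y)   ≈⟨ -‿distribʳ-* (- x) y ⟩
    - x * - y     ∎

  *-homo : ∀ i j → ⟦ i ℤ.* j ⟧ℤ ≈ ⟦ i ⟧ℤ * ⟦ j ⟧ℤ
  *-homo i j = begin
    ⟦ s ◃ ∣ i ∣ ℕ.* ∣ j ∣ ⟧ℤ                                    ≈⟨ ◃-homo s (∣ i ∣ ℕ.* ∣ j ∣) ⟩
    signed s ((∣ i ∣ ℕ.* ∣ j ∣) × 1#)                           ≈⟨ signed-cong s (×1-homo-* ∣ i ∣ ∣ j ∣) ⟩
    signed s ((∣ i ∣ × 1#) * (∣ j ∣ × 1#))                      ≈⟨ signed-* (sign i) (sign j) _ _ ⟩
    signed (sign i) (∣ i ∣ × 1#) * signed (sign j) (∣ j ∣ × 1#) ≡⟨ ≡.cong₂ _*_ (⟦⟧ℤ≡signed i) (⟦⟧ℤ≡signed j) ⟨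
    ⟦ i ⟧ℤ * ⟦ j ⟧ℤ                                             ∎
    where s = sign i Sign.* sign j

  ℤ-morphism : +-*-rawRing -Raw-AlmostCommutative⟶ fromCommutativeRing R
  ℤ-morphism = record
    { ⟦_⟧    = ⟦_⟧ℤ
    ; +-homo = +-homo
    ; *-homo = *-homo
    ; -‿homo = -‿homo
    ; 0-homo = refl
    ; 1-homo = refl
    }

  _≟⟦⟧ℤ_ : ∀ i j → Maybe (⟦ i ⟧ℤ ≈ ⟦ j ⟧ℤ)
  i ≟⟦⟧ℤ j with i ≟ℤ j
  ... | yes ≡.refl = just refl
  ... | no _       = nothing

  open import Algebra.Solver.Ring +-*-rawRing (fromCommutativeRing R) ℤ-morphism _≟⟦⟧ℤ_ public

  0ₚ 1ₚ -1ₚ 2ₚ : ∀ {n} → Polynomial n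
  0ₚ  = con (+ 0)
  1ₚ  = con (+ 1)
  -1ₚ = :- 1ₚ
  2ₚ  = 1ₚ :+ 1ₚ

module FieldProperties {c ℓ} (F : Field c ℓ) where
  open Field F
  open CommutativeRingSolver commutativeRing using (Polynomial; solve; _:=_; _:+_; _:*_; _:-_; :-_; 0ₚ; 1ₚ; -1ₚ; 2ₚ)
  open import Relation.Binary.Reasoning.Setoid setoid

  *≈1⇒≉0 : ∀ {x y} → x * y ≈ 1# → ¬ x ≈ 0#
  *≈1⇒≉0 {x} {y} xy≈1 x≈0 = 0≉1 (begin
    0#      ≈⟨ zeroˡ y ⟨
    0# * y  ≈⟨ *-congʳ x≈0 ⟨
    x * y   ≈⟨ xy≈1 ⟩
    1#      ∎)

  ⁻¹-unique : ∀ {x y} → x * y ≈ 1# → x ⁻¹ ≈ y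
  ⁻¹-unique {x} {y} xy≈1 = begin
    x ⁻¹            ≈⟨ *-identityʳ _ ⟨
    x ⁻¹ * 1#       ≈⟨ *-congˡ xy≈1 ⟨
    x ⁻¹ * (x * y)  ≈⟨ solve 3 (λ u x y → u :* (x :* y) := (x :* u) :* y) refl (x ⁻¹) x y ⟩
    (x * x ⁻¹) * y  ≈⟨ *-congʳ (inverse x (*≈1⇒≉0 xy≈1)) ⟩
    1# * y          ≈⟨ *-identityˡ y ⟩
    y               ∎

  square-root : AlgClosed F → ∀ a → ∃ λ x → x ² ≈ a
  square-root closed a with closed 1 (- a ∷ 0# ∷ [])
  ... | x , x²-a≈0 = x , (begin
    x * x                                     ≈⟨ solve 2 (λ a x → x :* x := x²-a a x :+ a) refl a x ⟩
    (- a + x * (0# + x * (1# + x * 0#))) + a  ≈⟨ +-congʳ x²-a≈0 ⟩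
    0# + a                                    ≈⟨ +-identityˡ a ⟩
    a                                         ∎)
    where
    x²-a : Polynomial 2 → Polynomial 2 → Polynomial 2
    x²-a a x = :- a :+ x :* (0ₚ :+ x :* (1ₚ :+ x :* 0ₚ))

  1+1≉-1+-1 : CharZero F → ¬ (1# + 1# ≈ - 1# + - 1#)
  1+1≉-1+-1 charZero 2≈-2 = charZero 3 (begin
    fromℕ 4                        ≈⟨ solve 0 (4ₚ := 2ₚ :- (-1ₚ :+ -1ₚ)) refl ⟩
    (1# + 1#) - (- 1# + - 1#)      ≈⟨ +-congʳ 2≈-2 ⟩
    (- 1# + - 1#) - (- 1# + - 1#)  ≈⟨ -‿inverseʳ _ ⟩
    0#                             ∎)
    where
    4ₚ : Polynomial 0
    4ₚ = 1ₚ :+ (1ₚ :+ (1ₚ :+ (1ₚ :+ 0ₚ)))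

module Curves {c ℓ} (F : Field c ℓ) (lam : Field.Carrier F) where
  open Field F
  open FieldProperties F
  open CommutativeRingSolver commutativeRing using (Polynomial; solve; _:=_; _:+_; _:*_; _:-_; :-_; 1ₚ; -1ₚ; 2ₚ)
  open import Algebra.Properties.Ring ring using (-1*x≈-x; -‿involutive; -‿distribʳ-*)
  open import Relation.Binary.Reasoning.Setoid setoid

  ≈ₚ⇒subE≡𝒪 : ∀ P Q → _≈ₚ_ F P Q → subE F lam P Q ≡ 𝒪
  ≈ₚ⇒subE≡𝒪 𝒪           𝒪           _               = ≡.refl
  ≈ₚ⇒subE≡𝒪 (aff x₁ y₁) (aff x₂ y₂) (x₁≈x₂ , y₁≈y₂) with x₁ ≟ x₂
  ... | no x₁≉x₂ = ⊥-elim (x₁≉x₂ x₁≈x₂)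
  ... | yes _ with (y₁ - y₂) ≟ 0#
  ...   | yes _      = ≡.refl
  ...   | no y₁-y₂≉0 = ⊥-elim (y₁-y₂≉0 (trans (+-congˡ (-‿cong (sym y₁≈y₂))) (-‿inverseʳ y₁)))

  subE-≉𝒪 : ∀ {x₁ y₁ x₂ y₂} → ¬ x₁ ≈ x₂ → ¬ _≈ₚ_ F 𝒪 (subE F lam (aff x₁ y₁) (aff x₂ y₂))
  subE-≉𝒪 {x₁} {x₂ = x₂} x₁≉x₂ with x₁ ≟ x₂
  ... | no _      = λ ()
  ... | yes x₁≈x₂ = ⊥-elim (x₁≉x₂ x₁≈x₂)

  onX-of-x⁴≈-1 : ∀ {x y} → x ⁴ ≈ - 1# → y ² ≈ (1# + 1#) - lam → OnX F lam x y
  onX-of-x⁴≈-1 {x} {y} x⁴≈-1 y²≈2-λ = begin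
    y * y                                ≈⟨ y²≈2-λ ⟩
    (1# + 1#) - lam                      ≈⟨ solve 1 (λ l → 2ₚ :- l := -1ₚ :* -1ₚ :+ l :* -1ₚ :+ 1ₚ) refl lam ⟩
    (- 1#) * (- 1#) + lam * (- 1#) + 1#  ≈⟨ +-congʳ (+-cong (*-cong x⁴≈-1 x⁴≈-1) (*-congˡ x⁴≈-1)) ⟨
    x ⁴ * x ⁴ + lam * x ⁴ + 1#           ∎

  onX-at-1 : ∀ {y} → y ² ≈ (1# + 1#) + lam → OnX F lam 1# y
  onX-at-1 y²≈2+λ = trans y²≈2+λ (solve 1 (λ l → 2ₚ :+ l := 1ₚ⁴ :* 1ₚ⁴ :+ l :* 1ₚ⁴ :+ 1ₚ) refl lam)
    where
    1ₚ⁴ : Polynomial 1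
    1ₚ⁴ = (1ₚ :* 1ₚ) :* (1ₚ :* 1ₚ)

  module _ (i : Carrier) (i²≈-1 : i * i ≈ - 1#) where

    i*-i≈1 : i * - i ≈ 1#
    i*-i≈1 = begin
      i * - i    ≈⟨ -‿distribʳ-* i i ⟨
      - (i * i)  ≈⟨ -‿cong i²≈-1 ⟩
      - - 1#     ≈⟨ -‿involutive 1# ⟩
      1#         ∎

    [ix]²≈-x² : ∀ x → (i * x) * (i * x) ≈ - (x * x)
    [ix]²≈-x² x = begin
      (i * x) * (i * x)  ≈⟨ solve 2 (λ i x → (i :* x) :* (i :* x) := (i :* i) :* (x :* x)) refl i x ⟩
      (i * i) * (x * x)  ≈⟨ *-congʳ i²≈-1 ⟩
      - 1# * (x * x)     ≈⟨ -1*x≈-x (x * x) ⟩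
      - (x * x)          ∎

    module AtSqrtOfI {r : Carrier} (r²≈i : r * r ≈ i) where

      r⁴≈-1 : r ⁴ ≈ - 1#
      r⁴≈-1 = trans (*-cong r²≈i r²≈i) i²≈-1

      r²*-i≈1 : (r * r) * - i ≈ 1#
      r²*-i≈1 = trans (*-congʳ r²≈i) i*-i≈1

      r*[r*-i]≈1 : r * (r * - i) ≈ 1#
      r*[r*-i]≈1 = trans (sym (*-assoc r r (- i))) r²*-i≈1

      r≉0 : ¬ r ≈ 0#
      r≉0 = *≈1⇒≉0 r*[r*-i]≈1

      r⁻¹≈r*-i : r ⁻¹ ≈ r * - i
      r⁻¹≈r*-i = ⁻¹-unique r*[r*-i]≈1

      [r²]⁻¹≈-i : (r * r) ⁻¹ ≈ - i
      [r²]⁻¹≈-i = ⁻¹-unique r²*-i≈1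

      [ir]²≈-i : (i * r) * (i * r) ≈ - i
      [ir]²≈-i = trans ([ix]²≈-x² r) (-‿cong r²≈i)

      [[ir]²]⁻¹≈i : ((i * r) * (i * r)) ⁻¹ ≈ i
      [[ir]²]⁻¹≈i = ⁻¹-unique (begin
        ((i * r) * (i * r)) * i  ≈⟨ *-congʳ [ir]²≈-i ⟩
        - i * i                  ≈⟨ *-comm (- i) i ⟩
        i * - i                  ≈⟨ i*-i≈1 ⟩
        1#                       ∎)

      [ir]⁻¹≈-r : (i * r) ⁻¹ ≈ - r
      [ir]⁻¹≈-r = ⁻¹-unique (begin
        (i * r) * - r  ≈⟨ solve 2 (λ i r → (i :* r) :* (:- r) := i :* (:- (r :* r))) refl i r ⟩
        i * - (r * r)  ≈⟨ *-congˡ (-‿cong r²≈i) ⟩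
        i * - i        ≈⟨ i*-i≈1 ⟩
        1#             ∎)

      f≈f∘σ : ∀ y → _≈ₚ_ F (f F lam r y) (f F lam (σx F lam i r) y)
      f≈f∘σ y = x-coordinates , y-coordinates
        where
        x-coordinates : r * r + (r * r) ⁻¹ ≈ (i * r) * (i * r) + ((i * r) * (i * r)) ⁻¹
        x-coordinates = begin
          r * r + (r * r) ⁻¹                          ≈⟨ +-cong r²≈i [r²]⁻¹≈-i ⟩
          i - i                                       ≈⟨ -‿inverseʳ i ⟩
          0#                                          ≈⟨ -‿inverseˡ i ⟨
          - i + i                                     ≈⟨ +-cong [ir]²≈-i [[ir]²]⁻¹≈i ⟨
          (i * r) * (i * r) + ((i * r) * (i * r)) ⁻¹  ∎

        y-coordinates : (y * (r * r) ⁻¹) * (r + r ⁻¹)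
                      ≈ (y * ((i * r) * (i * r)) ⁻¹) * (i * r + (i * r) ⁻¹)
        y-coordinates = begin
          (y * (r * r) ⁻¹) * (r + r ⁻¹)
            ≈⟨ *-cong (*-congˡ [r²]⁻¹≈-i) (+-congˡ r⁻¹≈r*-i) ⟩
          (y * - i) * (r + r * - i)
            ≈⟨ solve 3 (λ y i r → (y :* :- i) :* (r :+ r :* :- i) := (y :* i) :* (i :* r :- r)) refl y i r ⟩
          (y * i) * (i * r - r)
            ≈⟨ *-cong (*-congˡ [[ir]²]⁻¹≈i) (+-congˡ [ir]⁻¹≈-r) ⟨
          (y * ((i * r) * (i * r)) ⁻¹) * (i * r + (i * r) ⁻¹)  ∎

      fMinusFσ≡𝒪 : ∀ y → fMinusFσ F lam i r y ≡ 𝒪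
      fMinusFσ≡𝒪 y = ≈ₚ⇒subE≡𝒪 (f F lam r y) (f F lam (σx F lam i r) y) (f≈f∘σ y)

    fMinusFσ-at-1≉𝒪 : CharZero F → ∀ y → ¬ _≈ₚ_ F 𝒪 (fMinusFσ F lam i 1# y)
    fMinusFσ-at-1≉𝒪 charZero y = subE-≉𝒪 λ x-coordinates → 1+1≉-1+-1 charZero (begin
      1# + 1#                                         ≈⟨ +-cong (*-identityˡ 1#) [1²]⁻¹≈1 ⟨
      1# * 1# + (1# * 1#) ⁻¹                          ≈⟨ x-coordinates ⟩
      (i * 1#) * (i * 1#) + ((i * 1#) * (i * 1#)) ⁻¹  ≈⟨ +-cong [i]²≈-1 [[i]²]⁻¹≈-1 ⟩
      - 1# + - 1#                                     ∎)
      where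
      [1²]⁻¹≈1 : (1# * 1#) ⁻¹ ≈ 1#
      [1²]⁻¹≈1 = ⁻¹-unique (trans (*-identityʳ _) (*-identityˡ 1#))

      [i]²≈-1 : (i * 1#) * (i * 1#) ≈ - 1#
      [i]²≈-1 = trans ([ix]²≈-x² 1#) (-‿cong (*-identityˡ 1#))

      [[i]²]⁻¹≈-1 : ((i * 1#) * (i * 1#)) ⁻¹ ≈ - 1#
      [[i]²]⁻¹≈-1 = ⁻¹-unique (begin
        ((i * 1#) * (i * 1#)) * - 1#  ≈⟨ *-congʳ [i]²≈-1 ⟩
        - 1# * - 1#                   ≈⟨ -1*x≈-x (- 1#) ⟩
        - - 1#                        ≈⟨ -‿involutive 1# ⟩
        1#                            ∎)

lemma7p2 : (F : Field 0ℓ 0ℓ) → IsAlgClosureOfNumberField F →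
    (i lam : Field.Carrier F) →
    Field._≈_ F (Field._*_ F i i) (Field.-_ F (Field.1# F)) →
    ¬ (Field._≈_ F (Field._-_ F (Field._² F lam) (Field.fromℕ F 4)) (Field.0# F)) →
    NonConstant F lam i
lemma7p2 F (charZero , closed , _) i lam i²≈-1 _ =
  r , s , 1# , t ,
  onX-of-x⁴≈-1 r⁴≈-1 s²≈2-λ , r≉0 , onX-at-1 t²≈2+λ , (λ 1≈0 → 0≉1 (sym 1≈0)) ,
  ≡.subst (λ P → ¬ _≈ₚ_ F P (fMinusFσ F lam i 1# t)) (≡.sym (fMinusFσ≡𝒪 s))
    (fMinusFσ-at-1≉𝒪 i i²≈-1 charZero t)
  where
  open Field F
  open FieldProperties F using (square-root)
  open Curves F lam

  √i : ∃ λ r → r ² ≈ i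
  √i = square-root closed i

  r s t : Carrier
  r = proj₁ √i
  s = proj₁ (square-root closed ((1# + 1#) - lam))
  t = proj₁ (square-root closed ((1# + 1#) + lam))

  s²≈2-λ : s ² ≈ (1# + 1#) - lam
  s²≈2-λ = proj₂ (square-root closed ((1# + 1#) - lam))

  t²≈2+λ : t ² ≈ (1# + 1#) + lam
  t²≈2+λ = proj₂ (square-root closed ((1# + 1#) + lam))

  open AtSqrtOfI i i²≈-1 (proj₂ √i)
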